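{- For every nonempty composition $\alpha=(\alpha_1,\dots,\alpha_{l})$, $\mathrm{MaxOne}(M_\alpha)=(-1)^{l-1}\alpha_1$ and $\mathrm{MinOne}(M_\alpha)=(-1)^{l-1}\alpha_{l}$.
   Context: $M_\alpha=\sum_{i_1<\dots<i_l}x_{i_1}^{\alpha_1}\cdots x_{i_l}^{\alpha_l}$ is the monomial quasisymmetric function and $L_\alpha=\sum_{\beta\text{ refines }\alpha}M_\beta$ the fundamental one. $\mathrm{MinOne}$ and $\mathrm{MaxOne}$ are the linear functionals on quasisymmetric functions with $\mathrm{MinOne}(L_\alpha)=(-1)^k$ if $\alpha=(1^k,n-k)$ for some $0\le k<n$ and $0$ otherwise, and $\mathrm{MaxOne}(L_\alpha)=(-1)^k$ if $\alpha=(n-k,1^k)$ for some $0\le k<n$ and $0$ otherwise ($n=|\alpha|$). -}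

module Defs where

open import Data.Nat using (ℕ; zero; suc; _<_; _≡ᵇ_)
open import Data.Integer as ℤ using (ℤ; 0ℤ; 1ℤ; -1ℤ; _*_; _+_; _^_)
open import Data.List using (List; []; _∷_; _++_; map; concatMap; foldr; length)
open import Data.List.Relation.Unary.All using (All)
open import Data.Product using (_×_; _,_)
open import Data.Bool using (Bool; true; false; if_then_else_)
open import Relation.Binary.PropositionalEquality using (_≡_)

IsComposition : List ℕ → Set
IsComposition α = All (0 <_) α

-- All compositions of n (each exactly once).
-- compositions (n+2) is obtained from compositions (n+1) by either
-- prepending a part 1 or increasing the first part by 1.
incHead : List ℕ → List ℕ
incHead []      = []
incHead (a ∷ γ) = suc a ∷ γ

compositions : ℕ → List (List ℕ)
compositions zero          = [] ∷ []
compositions (suc zero)    = (1 ∷ []) ∷ []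
compositions (suc (suc n)) =
  concatMap (λ γ → (1 ∷ γ) ∷ incHead γ ∷ []) (compositions (suc n))

refinements : List ℕ → List (List ℕ)
refinements []      = [] ∷ []
refinements (a ∷ α) =
  concatMap (λ γ → map (γ ++_) (refinements α)) (compositions a)

-- Quasisymmetric functions (with integer coefficients), written in the
-- monomial basis: a finite formal ℤ-linear combination of the M_α.
QSym : Set
QSym = List (ℤ × List ℕ)

M : List ℕ → QSym
M α = (1ℤ , α) ∷ []

L : List ℕ → QSym
L α = map (λ β → (1ℤ , β)) (refinements α)

-- A linear functional on QSym is determined by its values φ β = φ(M_β);
-- apply φ f is its linear extension.
apply : (List ℕ → ℤ) → QSym → ℤ
apply φ f = foldr (λ { (c , β) r → c * φ β + r }) 0ℤ f

allOnes : List ℕ → Bool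
allOnes []      = true
allOnes (a ∷ β) = if a ≡ᵇ 1 then allOnes β else false

-- Prescribed value MinOne(L_α): (-1)^k if α = (1^k, n-k), 0 ≤ k < n; else 0.
-- (For a composition α, this means α is nonempty and all parts except the
-- last equal 1; then k = l(α) - 1.)
minOneL : List ℕ → ℤ
minOneL []            = 0ℤ
minOneL (a ∷ [])      = 1ℤ
minOneL (a ∷ b ∷ β)   = if a ≡ᵇ 1 then ℤ.- minOneL (b ∷ β) else 0ℤ

maxOneL : List ℕ → ℤ
maxOneL []      = 0ℤ
maxOneL (a ∷ β) = if allOnes β then -1ℤ ^ length β else 0ℤ

-- φ is the functional MinOne / MaxOne (determined by its values on the L basis).
IsMinOne : (List ℕ → ℤ) → Set
IsMinOne φ = ∀ α → IsComposition α → apply φ (L α) ≡ minOneL α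

IsMaxOne : (List ℕ → ℤ) → Set
IsMaxOne φ = ∀ α → IsComposition α → apply φ (L α) ≡ maxOneL α

lastPart : ℕ → List ℕ → ℕ
lastPart a []      = a
lastPart a (b ∷ α) = lastPart b α

-- Since L_α = M_α + Σ { M_β | β a strict refinement of α }, the passage from
-- the M basis to the L basis is unitriangular, so a functional is determined
-- by its values on the L_α.  It therefore suffices to exhibit functions on
-- compositions whose sums over refinements are the prescribed values: these
-- are f(β) = (-1)^(l(β)-1) β₁ for MaxOne and g(β) = (-1)^(l(β)-1) β_l for
-- MinOne.  A refinement of α is a concatenation γ ++ ρ of a composition γ of
-- α₁ and a refinement ρ of the remaining parts, and
-- f(γ ++ ρ) = f(γ) (-1)^l(ρ), g(γ ++ ρ) = (-1)^l(γ) g(ρ), so the refinement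
-- sums factor over the parts of α.  The factors are computed from
-- Σ { (-1)^l(γ) | γ composition of n }, which is -1 for n = 1 and 0 otherwise.
module Submission where

open import Defs
open import Data.Nat as ℕ using (ℕ; zero; suc; _<_; _≤_; z≤n; s≤s; _≡ᵇ_)
import Data.Nat.Properties as ℕ
open import Data.Integer using (ℤ; -1ℤ; 0ℤ; 1ℤ; _*_; _^_; +_; _+_; -_; _-_)
import Data.Integer.Properties as ℤ
open import Data.Integer.Tactic.RingSolver using (solve-∀)
open import Data.List using (List; []; _∷_; length; _++_; map; concatMap)
open import Data.List.Properties using (length-++; ++-identityʳ)
open import Data.Nat.ListAction using (sum)
open import Data.Nat.ListAction.Properties using (sum-++)
open import Data.List.Relation.Unary.All as All using (All; []; _∷_)
open import Data.List.Relation.Unary.All.Properties using (++⁺; map⁺)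
open import Data.Product using (_×_; _,_)
open import Data.Bool using (true; false; if_then_else_)
open import Data.Empty using (⊥-elim)
open import Function using (_∘_)
open import Relation.Binary.PropositionalEquality
open ≡-Reasoning

private variable A B : Set

∑ : (A → ℤ) → List A → ℤ
∑ f []       = 0ℤ
∑ f (x ∷ xs) = f x + ∑ f xs

∑-++ : ∀ (f : A → ℤ) xs ys → ∑ f (xs ++ ys) ≡ ∑ f xs + ∑ f ys
∑-++ f []       ys = sym (ℤ.+-identityˡ _)
∑-++ f (x ∷ xs) ys = trans (cong (_+_ (f x)) (∑-++ f xs ys)) (sym (ℤ.+-assoc (f x) _ _))

∑-map : ∀ (f : B → ℤ) (g : A → B) xs → ∑ f (map g xs) ≡ ∑ (λ x → f (g x)) xs
∑-map f g []       = refl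
∑-map f g (x ∷ xs) = cong (_+_ (f (g x))) (∑-map f g xs)

∑-concatMap : ∀ (f : B → ℤ) (g : A → List B) xs →
  ∑ f (concatMap g xs) ≡ ∑ (λ x → ∑ f (g x)) xs
∑-concatMap f g []       = refl
∑-concatMap f g (x ∷ xs) =
  trans (∑-++ f (g x) (concatMap g xs)) (cong (_+_ (∑ f (g x))) (∑-concatMap f g xs))

∑-cong : ∀ {P : A → Set} {f g : A → ℤ} {xs} → All P xs →
  (∀ {x} → P x → f x ≡ g x) → ∑ f xs ≡ ∑ g xs
∑-cong []       h = refl
∑-cong (p ∷ ps) h = cong₂ _+_ (h p) (∑-cong ps h)

∑-zero : ∀ {P : A → Set} {f : A → ℤ} {xs} → All P xs →
  (∀ {x} → P x → f x ≡ 0ℤ) → ∑ f xs ≡ 0ℤ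
∑-zero []       h = refl
∑-zero (p ∷ ps) h = cong₂ _+_ (h p) (∑-zero ps h)

∑-sub : ∀ (f g : A → ℤ) xs → ∑ (λ x → f x - g x) xs ≡ ∑ f xs - ∑ g xs
∑-sub f g []       = refl
∑-sub f g (x ∷ xs) = trans (cong (_+_ (f x - g x)) (∑-sub f g xs)) (interchange (f x) (g x) _ _)
  where
  interchange : ∀ a b c d → a - b + (c - d) ≡ (a + c) - (b + d)
  interchange = solve-∀

∑-*ˡ : ∀ c (f : A → ℤ) xs → ∑ (λ x → c * f x) xs ≡ c * ∑ f xs
∑-*ˡ c f []       = sym (ℤ.*-zeroʳ c)
∑-*ˡ c f (x ∷ xs) =
  trans (cong (_+_ (c * f x)) (∑-*ˡ c f xs)) (sym (ℤ.*-distribˡ-+ c (f x) _))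

∑-*ʳ : ∀ c (f : A → ℤ) xs → ∑ (λ x → f x * c) xs ≡ ∑ f xs * c
∑-*ʳ c f []       = refl
∑-*ʳ c f (x ∷ xs) =
  trans (cong (_+_ (f x * c)) (∑-*ʳ c f xs)) (sym (ℤ.*-distribʳ-+ c (f x) _))

∑-concat-product : ∀ {P Q : List A → Set} (f g h : List A → ℤ) {C R} →
  All P C → All Q R → (∀ {γ ρ} → P γ → Q ρ → f (γ ++ ρ) ≡ g γ * h ρ) →
  ∑ f (concatMap (λ γ → map (γ ++_) R) C) ≡ ∑ g C * ∑ h R
∑-concat-product {P = P} f g h {C} {R} pC qR split = begin
  ∑ f (concatMap (λ γ → map (γ ++_) R) C)  ≡⟨ ∑-concatMap f _ C ⟩
  ∑ (λ γ → ∑ f (map (γ ++_) R)) C          ≡⟨ ∑-cong pC row ⟩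
  ∑ (λ γ → g γ * ∑ h R) C                  ≡⟨ ∑-*ʳ (∑ h R) g C ⟩
  ∑ g C * ∑ h R                            ∎
  where
  row : ∀ {γ} → P γ → ∑ f (map (γ ++_) R) ≡ g γ * ∑ h R
  row {γ} p = begin
    ∑ f (map (γ ++_) R)        ≡⟨ ∑-map f (γ ++_) R ⟩
    ∑ (λ ρ → f (γ ++ ρ)) R     ≡⟨ ∑-cong qR (split p) ⟩
    ∑ (λ ρ → g γ * h ρ) R      ≡⟨ ∑-*ˡ (g γ) h R ⟩
    g γ * ∑ h R                ∎

IsCompositionOf : ℕ → List ℕ → Set
IsCompositionOf n γ = IsComposition γ × sum γ ≡ n

incHead-composition : ∀ {n γ} → IsCompositionOf (suc n) γ →
  IsCompositionOf (suc (suc n)) (incHead γ)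
incHead-composition {γ = []}    (_ , ())
incHead-composition {γ = b ∷ δ} (_ ∷ ps , s) = s≤s z≤n ∷ ps , cong suc s

compositions-sound : ∀ n → All (IsCompositionOf (suc n)) (compositions (suc n))
compositions-sound zero    = (s≤s z≤n ∷ [] , refl) ∷ []
compositions-sound (suc n) = go (compositions-sound n)
  where
  go : ∀ {γs} → All (IsCompositionOf (suc n)) γs →
       All (IsCompositionOf (suc (suc n))) (concatMap (λ γ → (1 ∷ γ) ∷ incHead γ ∷ []) γs)
  go []             = []
  go ((c , s) ∷ ps) = (s≤s z≤n ∷ c , cong suc s) ∷ incHead-composition (c , s) ∷ go ps

1≤length : ∀ {n γ} → IsCompositionOf (suc n) γ → 1 ≤ length γ
1≤length {γ = []}    (_ , ())
1≤length {γ = _ ∷ _} _ = s≤s z≤n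

2≤length : ∀ {n γ} → IsCompositionOf (suc n) γ → γ ≢ suc n ∷ [] → 2 ≤ length γ
2≤length {γ = []}        (_ , ())
2≤length {γ = b ∷ []}    (_ , s) γ≢n = ⊥-elim (γ≢n (cong (_∷ []) (trans (sym (ℕ.+-identityʳ b)) s)))
2≤length {γ = _ ∷ _ ∷ _} _ _ = s≤s (s≤s z≤n)

length≤sum : ∀ {α} → IsComposition α → length α ≤ sum α
length≤sum []       = z≤n
length≤sum (p ∷ ps) = ℕ.+-mono-≤ p (length≤sum ps)

∑-compositions-suc : ∀ n (f : List ℕ → ℤ) →
  ∑ f (compositions (suc (suc n))) ≡ ∑ (λ γ → f (1 ∷ γ) + f (incHead γ)) (compositions (suc n))
∑-compositions-suc n f =
  trans (∑-concatMap f _ (compositions (suc n)))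
        (∑-cong (compositions-sound n) λ {γ} _ → cong (_+_ (f (1 ∷ γ))) (ℤ.+-identityʳ _))

∑-compositions-stable : ∀ (f : List ℕ → ℤ) →
  (∀ {n γ} → IsCompositionOf (suc n) γ → f (1 ∷ γ) + f (incHead γ) ≡ f γ) →
  ∀ n → ∑ f (compositions (suc n)) ≡ f (1 ∷ [])
∑-compositions-stable f stable zero    = ℤ.+-identityʳ _
∑-compositions-stable f stable (suc n) = begin
  ∑ f (compositions (suc (suc n)))                          ≡⟨ ∑-compositions-suc n f ⟩
  ∑ (λ γ → f (1 ∷ γ) + f (incHead γ)) (compositions (suc n)) ≡⟨ ∑-cong (compositions-sound n) stable ⟩
  ∑ f (compositions (suc n))                                ≡⟨ ∑-compositions-stable f stable n ⟩
  f (1 ∷ [])                                                ∎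

∑-compositions-single : ∀ n (f : List ℕ → ℤ) →
  (∀ {γ} → IsCompositionOf (suc n) γ → γ ≢ suc n ∷ [] → f γ ≡ 0ℤ) →
  ∑ f (compositions (suc n)) ≡ f (suc n ∷ [])
∑-compositions-single zero    f vanish = ℤ.+-identityʳ _
∑-compositions-single (suc n) f vanish = begin
  ∑ f (compositions (suc (suc n)))                           ≡⟨ ∑-compositions-suc n f ⟩
  ∑ (λ γ → f (1 ∷ γ) + f (incHead γ)) (compositions (suc n)) ≡⟨ ∑-cong (compositions-sound n) drop-1∷ ⟩
  ∑ (λ γ → f (incHead γ)) (compositions (suc n))             ≡⟨ ∑-compositions-single n _ vanish-incHead ⟩
  f (suc (suc n) ∷ [])                                       ∎
  where
  1∷γ≢single : ∀ {γ} → IsCompositionOf (suc n) γ → 1 ∷ γ ≢ suc (suc n) ∷ []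
  1∷γ≢single {[]} (_ , ())
  1∷γ≢single {_ ∷ _} _ ()
  drop-1∷ : ∀ {γ} → IsCompositionOf (suc n) γ → f (1 ∷ γ) + f (incHead γ) ≡ f (incHead γ)
  drop-1∷ {γ} (c , s) = begin
    f (1 ∷ γ) + f (incHead γ)
      ≡⟨ cong (_+ f (incHead γ)) (vanish (s≤s z≤n ∷ c , cong suc s) (1∷γ≢single (c , s))) ⟩
    0ℤ + f (incHead γ)        ≡⟨ ℤ.+-identityˡ _ ⟩
    f (incHead γ)             ∎
  incHead-single : ∀ {γ} → incHead γ ≡ suc (suc n) ∷ [] → γ ≡ suc n ∷ []
  incHead-single {_ ∷ _} refl = refl
  vanish-incHead : ∀ {γ} → IsCompositionOf (suc n) γ → γ ≢ suc n ∷ [] → f (incHead γ) ≡ 0ℤ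
  vanish-incHead p γ≢n = vanish (incHead-composition p) (γ≢n ∘ incHead-single)

-- Only the consequences of "ρ refines α" that the triangularity argument uses.
Refines : List ℕ → List ℕ → Set
Refines ρ α = IsComposition ρ × sum ρ ≡ sum α × length α ≤ length ρ

++-refines : ∀ {k a α γ ρ} → IsCompositionOf a γ → k ≤ length γ → Refines ρ α →
  IsComposition (γ ++ ρ) × sum (γ ++ ρ) ≡ a ℕ.+ sum α × k ℕ.+ length α ≤ length (γ ++ ρ)
++-refines {γ = γ} {ρ} (cγ , sγ) k≤γ (cρ , sρ , α≤ρ) =
  ++⁺ cγ cρ ,
  trans (sum-++ γ ρ) (cong₂ ℕ._+_ sγ sρ) ,
  subst (_ ≤_) (sym (length-++ γ)) (ℕ.+-mono-≤ k≤γ α≤ρ)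

refinements-sound : ∀ {α} → IsComposition α → All (λ ρ → Refines ρ α) (refinements α)
refinements-sound []                 = ([] , refl , z≤n) ∷ []
refinements-sound {suc a ∷ α} (_ ∷ cα) = go (compositions-sound a)
  where
  go : ∀ {γs} → All (IsCompositionOf (suc a)) γs →
       All (λ ρ → Refines ρ (suc a ∷ α)) (concatMap (λ γ → map (γ ++_) (refinements α)) γs)
  go []       = []
  go (p ∷ ps) =
    ++⁺ (map⁺ (All.map (++-refines {α = α} p (1≤length p)) (refinements-sound {α} cα))) (go ps)

∑-refinements-triangular : ∀ (d : List ℕ → ℤ) {α} → IsComposition α →
  (∀ {β} → IsComposition β → sum β ≡ sum α → length α < length β → d β ≡ 0ℤ) →
  ∑ d (refinements α) ≡ d α
∑-refinements-triangular d []                 vanish = ℤ.+-identityʳ _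
∑-refinements-triangular d {suc a ∷ α} (_ ∷ cα) vanish = begin
  ∑ d (concatMap (λ γ → map (γ ++_) (refinements α)) (compositions (suc a)))
    ≡⟨ ∑-concatMap d _ (compositions (suc a)) ⟩
  ∑ (λ γ → ∑ d (map (γ ++_) (refinements α))) (compositions (suc a))
    ≡⟨ ∑-compositions-single a _ split-head-vanishes ⟩
  ∑ d (map (suc a ∷_) (refinements α))
    ≡⟨ ∑-map d (suc a ∷_) (refinements α) ⟩
  ∑ (λ ρ → d (suc a ∷ ρ)) (refinements α)
    ≡⟨ ∑-refinements-triangular (λ ρ → d (suc a ∷ ρ)) cα
         (λ cρ sρ α<ρ → vanish (s≤s z≤n ∷ cρ) (cong (suc a ℕ.+_) sρ) (s≤s α<ρ)) ⟩
  d (suc a ∷ α) ∎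
  where
  split-head-vanishes : ∀ {γ} → IsCompositionOf (suc a) γ → γ ≢ suc a ∷ [] →
    ∑ d (map (γ ++_) (refinements α)) ≡ 0ℤ
  split-head-vanishes {γ} p γ≢a =
    trans (∑-map d (γ ++_) (refinements α)) (∑-zero (refinements-sound cα) λ r →
      let cγρ , sγρ , γρ≥ = ++-refines {α = α} p (2≤length p γ≢a) r in vanish cγρ sγρ γρ≥)

-- The fuel t bounds sum α ∸ length α, which strictly decreases under strict refinement.
refinement-sums-vanish : ∀ (d : List ℕ → ℤ) →
  (∀ {α} → IsComposition α → ∑ d (refinements α) ≡ 0ℤ) →
  ∀ t {α} → IsComposition α → sum α < length α ℕ.+ t → d α ≡ 0ℤ
refinement-sums-vanish d sums zero {α} c lt =
  ⊥-elim (ℕ.<⇒≱ lt (subst (_≤ sum α) (sym (ℕ.+-identityʳ (length α))) (length≤sum c)))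
refinement-sums-vanish d sums (suc t) {α} c lt =
  trans (sym (∑-refinements-triangular d c vanish)) (sums c)
  where
  vanish : ∀ {β} → IsComposition β → sum β ≡ sum α → length α < length β → d β ≡ 0ℤ
  vanish {β} cβ sβ α<β = refinement-sums-vanish d sums t cβ
    (subst (_< length β ℕ.+ t) (sym sβ)
      (ℕ.<-≤-trans lt (subst (_≤ length β ℕ.+ t) (sym (ℕ.+-suc (length α) t)) (ℕ.+-monoˡ-≤ t α<β))))

refinement-sums-injective : ∀ (φ ψ : List ℕ → ℤ) →
  (∀ {α} → IsComposition α → ∑ φ (refinements α) ≡ ∑ ψ (refinements α)) →
  ∀ {α} → IsComposition α → φ α ≡ ψ α
refinement-sums-injective φ ψ sums {α} c =
  ℤ.i-j≡0⇒i≡j (φ α) (ψ α)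
    (refinement-sums-vanish (λ β → φ β - ψ β) difference-sums (suc (sum α)) c
      (subst (sum α <_) (sym (ℕ.+-suc (length α) (sum α))) (s≤s (ℕ.m≤n+m (sum α) (length α)))))
  where
  difference-sums : ∀ {β} → IsComposition β → ∑ (λ β → φ β - ψ β) (refinements β) ≡ 0ℤ
  difference-sums {β} cβ = begin
    ∑ (λ β → φ β - ψ β) (refinements β)           ≡⟨ ∑-sub φ ψ (refinements β) ⟩
    ∑ φ (refinements β) - ∑ ψ (refinements β)     ≡⟨ cong (_- ∑ ψ (refinements β)) (sums cβ) ⟩
    ∑ ψ (refinements β) - ∑ ψ (refinements β)     ≡⟨ ℤ.+-inverseʳ (∑ ψ (refinements β)) ⟩
    0ℤ                                            ∎

apply-L : ∀ φ α → apply φ (L α) ≡ ∑ φ (refinements α)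
apply-L φ α = go (refinements α)
  where
  go : ∀ βs → apply φ (map (λ β → 1ℤ , β) βs) ≡ ∑ φ βs
  go []       = refl
  go (β ∷ βs) = cong₂ _+_ (ℤ.*-identityˡ (φ β)) (go βs)

apply-M : ∀ φ α → apply φ (M α) ≡ φ α
apply-M φ α = trans (ℤ.+-identityʳ _) (ℤ.*-identityˡ (φ α))

sign : List ℕ → ℤ
sign ρ = -1ℤ ^ length ρ

sign-++ : ∀ γ ρ → sign (γ ++ ρ) ≡ sign γ * sign ρ
sign-++ []      ρ = sym (ℤ.*-identityˡ _)
sign-++ (_ ∷ γ) ρ = trans (cong (-1ℤ *_) (sign-++ γ ρ)) (sym (ℤ.*-assoc -1ℤ (sign γ) (sign ρ)))

sign-incHead : ∀ γ → sign (incHead γ) ≡ sign γ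
sign-incHead []      = refl
sign-incHead (_ ∷ _) = refl

∑-sign-compositions : ∀ n → ∑ sign (compositions (suc n)) ≡ (if suc n ≡ᵇ 1 then -1ℤ else 0ℤ)
∑-sign-compositions zero    = refl
∑-sign-compositions (suc n) =
  trans (∑-compositions-suc n sign) (∑-zero (compositions-sound n) λ {γ} _ → begin
    -1ℤ * sign γ + sign (incHead γ)  ≡⟨ cong₂ _+_ (ℤ.-1*i≡-i (sign γ)) (sign-incHead γ) ⟩
    - sign γ + sign γ                ≡⟨ ℤ.+-inverseˡ (sign γ) ⟩
    0ℤ                               ∎)

∑-sign-refinements : ∀ {α} → IsComposition α →
  ∑ sign (refinements α) ≡ (if allOnes α then sign α else 0ℤ)
∑-sign-refinements []                 = refl
∑-sign-refinements {suc a ∷ α} (_ ∷ cα) = begin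
  ∑ sign (refinements (suc a ∷ α))
    ≡⟨ ∑-concat-product sign sign sign (compositions-sound a) (refinements-sound cα)
         (λ {γ} {ρ} _ _ → sign-++ γ ρ) ⟩
  ∑ sign (compositions (suc a)) * ∑ sign (refinements α)
    ≡⟨ cong₂ _*_ (∑-sign-compositions a) (∑-sign-refinements cα) ⟩
  (if suc a ≡ᵇ 1 then -1ℤ else 0ℤ) * (if allOnes α then sign α else 0ℤ)
    ≡⟨ head-factor a ⟩
  (if allOnes (suc a ∷ α) then sign (suc a ∷ α) else 0ℤ) ∎
  where
  head-factor : ∀ a → (if suc a ≡ᵇ 1 then -1ℤ else 0ℤ) * (if allOnes α then sign α else 0ℤ)
                      ≡ (if allOnes (suc a ∷ α) then sign (suc a ∷ α) else 0ℤ)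
  head-factor (suc _) = refl
  head-factor zero with allOnes α
  ... | true  = refl
  ... | false = refl

maxOneM : List ℕ → ℤ
maxOneM []      = 0ℤ
maxOneM (b ∷ δ) = sign δ * + b

maxOneM-++ : ∀ b δ ρ → maxOneM (b ∷ δ ++ ρ) ≡ maxOneM (b ∷ δ) * sign ρ
maxOneM-++ b δ ρ = trans (cong (_* + b) (sign-++ δ ρ)) (*-swap (sign δ) (sign ρ) (+ b))
  where
  *-swap : ∀ x y z → x * y * z ≡ x * z * y
  *-swap = solve-∀

∑-maxOneM-compositions : ∀ n → ∑ maxOneM (compositions (suc n)) ≡ 1ℤ
∑-maxOneM-compositions = ∑-compositions-stable maxOneM stable
  where
  prepend-1 : ∀ s b → -1ℤ * s * 1ℤ + s * (1ℤ + b) ≡ s * b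
  prepend-1 = solve-∀
  stable : ∀ {n γ} → IsCompositionOf (suc n) γ → maxOneM (1 ∷ γ) + maxOneM (incHead γ) ≡ maxOneM γ
  stable {γ = []}    (_ , ())
  stable {γ = b ∷ δ} _ = prepend-1 (sign δ) (+ b)

∑-maxOneM-refinements : ∀ {α} → IsComposition α → ∑ maxOneM (refinements α) ≡ maxOneL α
∑-maxOneM-refinements []                 = refl
∑-maxOneM-refinements {suc a ∷ α} (_ ∷ cα) = begin
  ∑ maxOneM (refinements (suc a ∷ α))
    ≡⟨ ∑-concat-product maxOneM maxOneM sign (compositions-sound a) (refinements-sound cα) split ⟩
  ∑ maxOneM (compositions (suc a)) * ∑ sign (refinements α)
    ≡⟨ cong₂ _*_ (∑-maxOneM-compositions a) (∑-sign-refinements cα) ⟩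
  1ℤ * (if allOnes α then sign α else 0ℤ)
    ≡⟨ ℤ.*-identityˡ _ ⟩
  maxOneL (suc a ∷ α) ∎
  where
  split : ∀ {γ ρ} → IsCompositionOf (suc a) γ → Refines ρ α → maxOneM (γ ++ ρ) ≡ maxOneM γ * sign ρ
  split {[]}    (_ , ())
  split {b ∷ δ} {ρ} _ _ = maxOneM-++ b δ ρ

minOneM : List ℕ → ℤ
minOneM []          = 0ℤ
minOneM (b ∷ [])    = + b
minOneM (_ ∷ c ∷ δ) = - minOneM (c ∷ δ)

minOneM-lastPart : ∀ a α → minOneM (a ∷ α) ≡ sign α * + lastPart a α
minOneM-lastPart a []      = sym (ℤ.*-identityˡ _)
minOneM-lastPart a (b ∷ α) = begin
  - minOneM (b ∷ α)                    ≡⟨ cong -_ (minOneM-lastPart b α) ⟩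
  - (sign α * + lastPart b α)          ≡⟨ ℤ.neg-distribˡ-* (sign α) _ ⟩
  - sign α * + lastPart b α            ≡⟨ cong (_* + lastPart b α) (sym (ℤ.-1*i≡-i (sign α))) ⟩
  sign (b ∷ α) * + lastPart b α        ∎

minOneM-∷ : ∀ b γ c σ → minOneM (b ∷ γ ++ c ∷ σ) ≡ - minOneM (γ ++ c ∷ σ)
minOneM-∷ b []      c σ = refl
minOneM-∷ b (_ ∷ _) c σ = refl

minOneM-++ : ∀ γ c σ → minOneM (γ ++ c ∷ σ) ≡ sign γ * minOneM (c ∷ σ)
minOneM-++ []      c σ = sym (ℤ.*-identityˡ _)
minOneM-++ (b ∷ γ) c σ = begin
  minOneM (b ∷ γ ++ c ∷ σ)        ≡⟨ minOneM-∷ b γ c σ ⟩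
  - minOneM (γ ++ c ∷ σ)          ≡⟨ cong -_ (minOneM-++ γ c σ) ⟩
  - (sign γ * minOneM (c ∷ σ))    ≡⟨ ℤ.neg-distribˡ-* (sign γ) _ ⟩
  - sign γ * minOneM (c ∷ σ)      ≡⟨ cong (_* minOneM (c ∷ σ)) (sym (ℤ.-1*i≡-i (sign γ))) ⟩
  sign (b ∷ γ) * minOneM (c ∷ σ)  ∎

isSinglePart : List ℕ → ℤ
isSinglePart (_ ∷ []) = 1ℤ
isSinglePart _        = 0ℤ

∑-isSinglePart-compositions : ∀ n → ∑ isSinglePart (compositions (suc n)) ≡ 1ℤ
∑-isSinglePart-compositions = ∑-compositions-stable isSinglePart stable
  where
  stable : ∀ {n γ} → IsCompositionOf (suc n) γ →
    isSinglePart (1 ∷ γ) + isSinglePart (incHead γ) ≡ isSinglePart γ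
  stable {γ = []}        (_ , ())
  stable {γ = _ ∷ []}    _ = refl
  stable {γ = _ ∷ _ ∷ _} _ = refl

∑-minOneM-compositions : ∀ n → ∑ minOneM (compositions (suc n)) ≡ 1ℤ
∑-minOneM-compositions zero    = refl
∑-minOneM-compositions (suc n) = begin
  ∑ minOneM (compositions (suc (suc n)))
    ≡⟨ ∑-compositions-suc n minOneM ⟩
  ∑ (λ γ → minOneM (1 ∷ γ) + minOneM (incHead γ)) (compositions (suc n))
    ≡⟨ ∑-cong (compositions-sound n) pair ⟩
  ∑ isSinglePart (compositions (suc n))
    ≡⟨ ∑-isSinglePart-compositions n ⟩
  1ℤ ∎
  where
  neg+suc : ∀ x → - x + (1ℤ + x) ≡ 1ℤ
  neg+suc = solve-∀
  pair : ∀ {γ} → IsCompositionOf (suc n) γ →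
    minOneM (1 ∷ γ) + minOneM (incHead γ) ≡ isSinglePart γ
  pair {[]}        (_ , ())
  pair {b ∷ []}    _ = neg+suc (+ b)
  pair {b ∷ c ∷ δ} _ = ℤ.+-inverseˡ (minOneM (b ∷ c ∷ δ))

∑-minOneM-refinements : ∀ {α} → IsComposition α → ∑ minOneM (refinements α) ≡ minOneL α
∑-minOneM-refinements []                       = refl
∑-minOneM-refinements {suc a ∷ []} (_ ∷ [])    = begin
  ∑ minOneM (concatMap (λ γ → (γ ++ []) ∷ []) (compositions (suc a)))
    ≡⟨ ∑-concatMap minOneM _ (compositions (suc a)) ⟩
  ∑ (λ γ → minOneM (γ ++ []) + 0ℤ) (compositions (suc a))
    ≡⟨ ∑-cong (compositions-sound a) (λ {γ} _ → trans (ℤ.+-identityʳ _) (cong minOneM (++-identityʳ γ))) ⟩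
  ∑ minOneM (compositions (suc a))
    ≡⟨ ∑-minOneM-compositions a ⟩
  1ℤ ∎
∑-minOneM-refinements {suc a ∷ d ∷ α} (_ ∷ cα) = begin
  ∑ minOneM (refinements (suc a ∷ d ∷ α))
    ≡⟨ ∑-concat-product minOneM sign minOneM (compositions-sound a) (refinements-sound cα) split ⟩
  ∑ sign (compositions (suc a)) * ∑ minOneM (refinements (d ∷ α))
    ≡⟨ cong₂ _*_ (∑-sign-compositions a) (∑-minOneM-refinements cα) ⟩
  (if suc a ≡ᵇ 1 then -1ℤ else 0ℤ) * minOneL (d ∷ α)
    ≡⟨ head-factor a ⟩
  minOneL (suc a ∷ d ∷ α) ∎
  where
  split : ∀ {γ ρ} → IsCompositionOf (suc a) γ → Refines ρ (d ∷ α) →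
    minOneM (γ ++ ρ) ≡ sign γ * minOneM ρ
  split {γ} {[]}    _ (_ , _ , ())
  split {γ} {c ∷ σ} _ _ = minOneM-++ γ c σ
  head-factor : ∀ a → (if suc a ≡ᵇ 1 then -1ℤ else 0ℤ) * minOneL (d ∷ α) ≡ minOneL (suc a ∷ d ∷ α)
  head-factor zero    = ℤ.-1*i≡-i _
  head-factor (suc _) = refl

lemma3p2 : (maxOne minOne : List ℕ → ℤ) → IsMaxOne maxOne → IsMinOne minOne →
    (a : ℕ) (α : List ℕ) → IsComposition (a ∷ α) →
      (apply maxOne (M (a ∷ α)) ≡ (-1ℤ ^ length α) * (+ a))
      × (apply minOne (M (a ∷ α)) ≡ (-1ℤ ^ length α) * (+ lastPart a α))
lemma3p2 maxOne minOne isMaxOne isMinOne a α c =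
  trans (apply-M maxOne (a ∷ α)) (refinement-sums-injective maxOne maxOneM maxOne-sums c) ,
  (begin
    apply minOne (M (a ∷ α)) ≡⟨ apply-M minOne (a ∷ α) ⟩
    minOne (a ∷ α)           ≡⟨ refinement-sums-injective minOne minOneM minOne-sums c ⟩
    minOneM (a ∷ α)          ≡⟨ minOneM-lastPart a α ⟩
    sign α * + lastPart a α  ∎)
  where
  maxOne-sums : ∀ {β} → IsComposition β → ∑ maxOne (refinements β) ≡ ∑ maxOneM (refinements β)
  maxOne-sums {β} cβ =
    trans (sym (apply-L maxOne β)) (trans (isMaxOne β cβ) (sym (∑-maxOneM-refinements cβ)))
  minOne-sums : ∀ {β} → IsComposition β → ∑ minOne (refinements β) ≡ ∑ minOneM (refinements β)
  minOne-sums {β} cβ =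
    trans (sym (apply-L minOne β)) (trans (isMinOne β cβ) (sym (∑-minOneM-refinements cβ)))
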